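{- Let $\mathbf{s}$ be a sequence of positive integers and $n\geq1$. The cone $\mathcal{C}_n^{(\mathbf{s})}$ is Gorenstein if and only if there exists $\mathbf{c}=(c_1,\ldots,c_n)\in\mathbb{Z}^n$ with $c_1=1$ and $$c_j s_{j-1}=c_{j-1}s_j+\gcd(s_j,s_{j-1})\quad\text{for } 1<j\leq n.$$
   Context: $\mathcal{C}_n^{(\mathbf{s})}=\{\lambda\in\mathbb{R}^n: 0\leq\lambda_1/s_1\leq\lambda_2/s_2\leq\cdots\leq\lambda_n/s_n\}$. A pointed rational cone $\mathcal{C}\subset\mathbb{R}^n$ is Gorenstein if there is an integer point $\mathbf{c}$ in the interior $\mathcal{C}^\circ$ such that $\mathcal{C}^\circ\cap\mathbb{Z}^n=\mathbf{c}+(\mathcal{C}\cap\mathbb{Z}^n)$. -}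

module Defs where

open import Data.Nat using (ℕ; zero; suc)
open import Data.Nat.GCD using (gcd)
open import Data.Integer using (ℤ; +_; _+_; _*_; _≤_; _<_)
open import Data.Fin using (Fin; toℕ)
open import Data.Product using (Σ; _×_)
open import Relation.Binary.PropositionalEquality using (_≡_)
open import Function.Bundles using (_⇔_)

-- Points of ℤ^n are functions Fin n → ℤ.
-- Coordinates are 0-based: coordinate i (toℕ i = k) is the paper's λ_{k+1},
-- and s k is the paper's s_{k+1}.  s : ℕ → ℕ is the (infinite) sequence.

Point : ℕ → Set
Point n = Fin n → ℤ

-- λ ∈ C_n^(s) ∩ ℤ^n :  0 ≤ λ_1/s_1 ≤ λ_2/s_2 ≤ ... ≤ λ_n/s_n,
-- with the divisions cleared (all s_i > 0).
InCone : (s : ℕ → ℕ) (n : ℕ) → Point n → Set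
InCone s n λ' =
  (∀ (i : Fin n) → toℕ i ≡ 0 → + 0 ≤ λ' i) ×
  (∀ (i j : Fin n) → toℕ j ≡ suc (toℕ i) →
     λ' i * + s (toℕ j) ≤ λ' j * + s (toℕ i))

-- λ ∈ (C_n^(s))° ∩ ℤ^n : the cone is simplicial (n linearly independent
-- defining inequalities), so its interior is given by the strict inequalities
-- 0 < λ_1/s_1 < λ_2/s_2 < ... < λ_n/s_n.
InInterior : (s : ℕ → ℕ) (n : ℕ) → Point n → Set
InInterior s n λ' =
  (∀ (i : Fin n) → toℕ i ≡ 0 → + 0 < λ' i) ×
  (∀ (i j : Fin n) → toℕ j ≡ suc (toℕ i) →
     λ' i * + s (toℕ j) < λ' j * + s (toℕ i))

IsGorenstein : (n : ℕ) (inC inInt : Point n → Set) → Set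
IsGorenstein n inC inInt =
  Σ (Point n) λ c →
    inInt c ×
    (∀ (x : Point n) →
       inInt x ⇔ Σ (Point n) (λ y → inC y × (∀ i → x i ≡ c i + y i)))

GorensteinCone : (s : ℕ → ℕ) (n : ℕ) → Set
GorensteinCone s n = IsGorenstein n (InCone s n) (InInterior s n)

{-# OPTIONS --safe #-}
-- Both a·t and b·u are multiples of g = gcd t u, so for positive t, u the
-- strict inequality a·t < b·u is the same as a·t + g ≤ b·u.  If c satisfies the
-- recurrence, this says that x lies in the interior exactly when x − c lies in
-- the cone (c₁ = 1 plays the same role for the inequality 0 < λ₁).  Conversely,
-- let c be a Gorenstein point, so that c + y in the interior forces y into the
-- cone.  If c₁ > 1, then y = −e₁ contradicts this.  If the recurrence fails at
-- j, then c_j s_{j−1} > c_{j−1} s_j + g, and a Bézout pair a, b ≥ 0 with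
-- a s_j = b s_{j−1} + g gives the sequence y that vanishes before j − 1, is a, b
-- at j − 1, j and rises weakly afterwards: c + y stays in the interior while y
-- breaks the cone inequality between j − 1 and j.

module Submission where

open import Defs
open import Data.Nat using (ℕ; suc; _≤_; _<_)
open import Data.Nat.GCD using (gcd)
open import Data.Integer using (ℤ; +_; _+_; _*_)
open import Data.Fin using (Fin; toℕ)
open import Data.Product using (Σ; _×_)
open import Relation.Binary.PropositionalEquality using (_≡_)
open import Function.Bundles using (_⇔_)

open import Algebra.Bundles using (AbelianGroup)
open import Data.Fin.Properties using (toℕ-injective)
open import Data.Integer as ℤ using (_-_; -_; -[1+_]; +≤+; +<+; -≤+)
open import Data.Integer.Properties
  using ( +-0-abelianGroup; +-assoc; +-comm; +-identityʳ; *-assoc; *-distribʳ-+; suc-*; pos-*; pos-+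
        ; ≤-refl; ≤-antisym; ≮⇒≥; <⇒≱; i<j⇒suc[i]≤j; i≤j⇒0≤j-i; +-monoˡ-≤; +-monoʳ-<; +-monoˡ-<; +-mono-<-≤
        ; *-monoʳ-≤-nonNeg; *-cancelʳ-<-nonNeg; module ≤-Reasoning )
import Data.Integer.Tactic.RingSolver as ℤ-Solver
open import Algebra.Properties.Group (AbelianGroup.group +-0-abelianGroup) using (∙-cancelˡ)
open import Data.List using ([]; _∷_)
open import Data.Nat as ℕ using (zero; z≤n)
import Data.Nat.Properties as ℕₚ
open import Algebra.Properties.CommutativeSemigroup ℕₚ.*-commutativeSemigroup using (xy∙z≈xz∙y)
open import Data.Nat.Divisibility using (divides)
open import Data.Nat.GCD using (gcd[m,n]∣m; gcd[m,n]∣n; gcd[m,n]≢0; gcd-GCD; module Bézout)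
import Data.Nat.Tactic.RingSolver as ℕ-Solver
open import Data.Product using (_,_; proj₁; proj₂; ∃₂)
open import Data.Sum using (inj₁)
open import Function.Bundles using (mk⇔; Equivalence)
open import Relation.Nullary using (¬_; yes; no; contradiction)
open import Relation.Binary.PropositionalEquality
  using (refl; sym; trans; cong; subst; subst₂; _≢_; _≗_; module ≡-Reasoning)

m*d<n*d⇒m*d+d≤n*d : ∀ m n d → m * + d ℤ.< n * + d → m * + d + + d ℤ.≤ n * + d
m*d<n*d⇒m*d+d≤n*d m n d m*d<n*d = begin
  m * + d + + d  ≡⟨ +-comm (m * + d) (+ d) ⟩
  + d + m * + d  ≡⟨ suc-* m (+ d) ⟨
  ℤ.suc m * + d  ≤⟨ *-monoʳ-≤-nonNeg (+ d) (i<j⇒suc[i]≤j m<n) ⟩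
  n * + d        ∎
  where
  open ≤-Reasoning
  m<n : m ℤ.< n
  m<n = *-cancelʳ-<-nonNeg (+ d) m*d<n*d

<⇒+gcd≤ : ∀ a b t u → a * + t ℤ.< b * + u → a * + t + + gcd t u ℤ.≤ b * + u
<⇒+gcd≤ a b t u at<bu with gcd[m,n]∣m t u | gcd[m,n]∣n t u
... | divides p t≡pg | divides q u≡qg =
  subst₂ (λ x y → x + + gcd t u ℤ.≤ y) (sym at≡apg) (sym bu≡bqg)
    (m*d<n*d⇒m*d+d≤n*d (a * + p) (b * + q) (gcd t u) (subst₂ ℤ._<_ at≡apg bu≡bqg at<bu))
  where
  scaled : ∀ c r {v} → v ≡ r ℕ.* gcd t u → c * + v ≡ c * + r * + gcd t u
  scaled c r v≡rg = trans (cong (λ v → c * + v) v≡rg)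
                      (trans (cong (c *_) (pos-* r (gcd t u))) (sym (*-assoc c (+ r) (+ gcd t u))))
  at≡apg : a * + t ≡ a * + p * + gcd t u
  at≡apg = scaled a p t≡pg
  bu≡bqg : b * + u ≡ b * + q * + gcd t u
  bu≡bqg = scaled b q u≡qg

0<gcd : ∀ t u → 0 < t → 0 < gcd t u
0<gcd t u 0<t = ℕₚ.n≢0⇒n>0 (gcd[m,n]≢0 t u (inj₁ (ℕₚ.n>0⇒n≢0 0<t)))

i<i+gcd : ∀ i t u → 0 < t → i ℤ.< i + + gcd t u
i<i+gcd i t u 0<t = subst (ℤ._< i + + gcd t u) (+-identityʳ i) (+-monoʳ-< i (+<+ (0<gcd t u 0<t)))

cross-+-<-≤ : ∀ a b y z t u → a * t ℤ.< b * u → y * t ℤ.≤ z * u → (a + y) * t ℤ.< (b + z) * u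
cross-+-<-≤ a b y z t u at<bu yt≤zu =
  subst₂ ℤ._<_ (sym (*-distribʳ-+ t a y)) (sym (*-distribʳ-+ u b z)) (+-mono-<-≤ at<bu yt≤zu)

gap-+-bézout : ∀ cᵢ cⱼ a b t u g → cᵢ * t + g ℤ.< cⱼ * u → g + b * u ≡ a * t →
  (cᵢ + a) * t ℤ.< (cⱼ + b) * u
gap-+-bézout cᵢ cⱼ a b t u g gap g+bu≡at = begin-strict
  (cᵢ + a) * t         ≡⟨ *-distribʳ-+ t cᵢ a ⟩
  cᵢ * t + a * t       ≡⟨ cong (λ z → cᵢ * t + z) g+bu≡at ⟨
  cᵢ * t + (g + b * u) ≡⟨ +-assoc (cᵢ * t) g (b * u) ⟨
  cᵢ * t + g + b * u   <⟨ +-monoˡ-< (b * u) gap ⟩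
  cⱼ * u + b * u       ≡⟨ *-distribʳ-+ u cⱼ b ⟨
  (cⱼ + b) * u         ∎
  where open ≤-Reasoning

gap-shift : ∀ xᵢ xⱼ cᵢ cⱼ t u g → xᵢ * t + g ℤ.≤ xⱼ * u → cⱼ * u ≡ cᵢ * t + g →
  (xᵢ - cᵢ) * t ℤ.≤ (xⱼ - cⱼ) * u
gap-shift xᵢ xⱼ cᵢ cⱼ t u g gap cⱼu≡cᵢt+g = begin
  (xᵢ - cᵢ) * t              ≡⟨ ℤ-Solver.solve (xᵢ ∷ cᵢ ∷ t ∷ g ∷ []) ⟩
  (xᵢ * t + g) - (cᵢ * t + g) ≤⟨ +-monoˡ-≤ (- (cᵢ * t + g)) gap ⟩
  xⱼ * u - (cᵢ * t + g)       ≡⟨ cong (λ z → xⱼ * u - z) cⱼu≡cᵢt+g ⟨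
  xⱼ * u - cⱼ * u             ≡⟨ ℤ-Solver.solve (xⱼ ∷ cⱼ ∷ u ∷ []) ⟩
  (xⱼ - cⱼ) * u               ∎
  where open ≤-Reasoning

-- With t = q + 1 and u = p + 1: adding (x + y)·(u, t) to the coefficients (−x, −y)
-- of g = y·u − x·t makes both of them nonnegative.
bézout-shift : ∀ g x y p q → g ℕ.+ x ℕ.* suc q ≡ y ℕ.* suc p →
  g ℕ.+ (x ℕ.* suc q ℕ.+ y ℕ.* q) ℕ.* suc p ≡ (x ℕ.* p ℕ.+ y ℕ.* suc p) ℕ.* suc q
bézout-shift g x y p q g+xt≡yu = ℕₚ.+-cancelʳ-≡ (y ℕ.* suc p) _ _ (begin
  g ℕ.+ (x ℕ.* suc q ℕ.+ y ℕ.* q) ℕ.* suc p ℕ.+ y ℕ.* suc p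
    ≡⟨ ℕ-Solver.solve (g ∷ x ∷ y ∷ p ∷ q ∷ []) ⟩
  (x ℕ.* p ℕ.+ y ℕ.* suc p) ℕ.* suc q ℕ.+ (g ℕ.+ x ℕ.* suc q)
    ≡⟨ cong ((x ℕ.* p ℕ.+ y ℕ.* suc p) ℕ.* suc q ℕ.+_) g+xt≡yu ⟩
  (x ℕ.* p ℕ.+ y ℕ.* suc p) ℕ.* suc q ℕ.+ y ℕ.* suc p ∎)
  where open ≡-Reasoning

bézout⁺ : ∀ t u → 0 < t → 0 < u → ∃₂ λ a b → gcd t u ℕ.+ b ℕ.* u ≡ a ℕ.* t
bézout⁺ (suc q) (suc p) _ _ with Bézout.identity (gcd-GCD (suc q) (suc p))
... | Bézout.+- x y g+yu≡xt = x , y , g+yu≡xt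
... | Bézout.-+ x y g+xt≡yu =
  x ℕ.* p ℕ.+ y ℕ.* suc p , x ℕ.* suc q ℕ.+ y ℕ.* q , bézout-shift _ x y p q g+xt≡yu

_⊕_ : ∀ {n} → Point n → Point n → Point n
(x ⊕ y) i = x i + y i

ShiftsConeToInterior : (s : ℕ → ℕ) (n : ℕ) → Point n → Set
ShiftsConeToInterior s n c =
  ∀ x → InInterior s n x ⇔ Σ (Point n) (λ y → InCone s n y × (∀ i → x i ≡ c i + y i))

GorensteinPoint : (s : ℕ → ℕ) (n : ℕ) → Point n → Set
GorensteinPoint s n c = InInterior s n c × ShiftsConeToInterior s n c

Recurrence : (s : ℕ → ℕ) (n : ℕ) → Point n → Set
Recurrence s n c =
  (∀ (i : Fin n) → toℕ i ≡ 0 → c i ≡ + 1) ×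
  (∀ (i j : Fin n) → toℕ j ≡ suc (toℕ i) →
     c j * + s (toℕ i) ≡ c i * + s (toℕ j) + + gcd (s (toℕ j)) (s (toℕ i)))

InCone-resp-≗ : ∀ {s n} {y z : Point n} → y ≗ z → InCone s n y → InCone s n z
InCone-resp-≗ {s} y≗z (y₀ , y-rises) =
  (λ i i≡0 → subst (+ 0 ℤ.≤_) (y≗z i) (y₀ i i≡0)) ,
  (λ i j j≡1+i → subst₂ (λ yᵢ yⱼ → yᵢ * + s (toℕ j) ℤ.≤ yⱼ * + s (toℕ i))
                   (y≗z i) (y≗z j) (y-rises i j j≡1+i))

InInterior-resp-≗ : ∀ {s n} {y z : Point n} → y ≗ z → InInterior s n y → InInterior s n z
InInterior-resp-≗ {s} y≗z (y₀ , y-rises) =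
  (λ i i≡0 → subst (+ 0 ℤ.<_) (y≗z i) (y₀ i i≡0)) ,
  (λ i j j≡1+i → subst₂ (λ yᵢ yⱼ → yᵢ * + s (toℕ j) ℤ.< yⱼ * + s (toℕ i))
                   (y≗z i) (y≗z j) (y-rises i j j≡1+i))

interior-+-cone : ∀ {s n} {x y : Point n} →
  InInterior s n x → InCone s n y → InInterior s n (x ⊕ y)
interior-+-cone {x = x} {y} (x₀ , x-rises) (y₀ , y-rises) =
  (λ i i≡0 → +-mono-<-≤ (x₀ i i≡0) (y₀ i i≡0)) ,
  (λ i j j≡1+i → cross-+-<-≤ (x i) (x j) (y i) (y j) _ _ (x-rises i j j≡1+i) (y-rises i j j≡1+i))

shifts⇒cone : ∀ {s n} {c y : Point n} →
  ShiftsConeToInterior s n c → InInterior s n (c ⊕ y) → InCone s n y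
shifts⇒cone {s} {c = c} {y} shifts c+y° with Equivalence.to (shifts (c ⊕ y)) c+y°
... | y′ , y′-cone , c+y≡c+y′ =
  InCone-resp-≗ {s} (λ i → ∙-cancelˡ (c i) (y′ i) (y i) (sym (c+y≡c+y′ i))) y′-cone

RisesAt : (ℕ → ℕ) → (ℕ → ℤ) → ℕ → Set
RisesAt s F l = F l * + s (suc l) ℤ.≤ F (suc l) * + s l

RisesAt⇒transition : ∀ s F {n} (i j : Fin n) → toℕ j ≡ suc (toℕ i) → RisesAt s F (toℕ i) →
  F (toℕ i) * + s (toℕ j) ℤ.≤ F (toℕ j) * + s (toℕ i)
RisesAt⇒transition s F i j j≡1+i rises rewrite j≡1+i = rises

-e₀ : ℕ → ℤ
-e₀ zero    = -[1+ 0 ]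
-e₀ (suc _) = + 0

-e₀-rises : ∀ s l → RisesAt s -e₀ l
-e₀-rises s zero    = *-monoʳ-≤-nonNeg (+ s 1) (-≤+ {0} {0})
-e₀-rises s (suc l) = ≤-refl

ℕ-RisesAt : ∀ s (f : ℕ → ℕ) l → f l ℕ.* s (suc l) ≤ f (suc l) ℕ.* s l →
  RisesAt s (λ k → + f k) l
ℕ-RisesAt s f l le = subst₂ ℤ._≤_ (pos-* (f l) (s (suc l))) (pos-* (f (suc l)) (s l)) (+≤+ le)

-- ramp s a b m is 0, …, 0, a, b, b·s (m + 2), b·s (m + 3), … with a at index m.
ramp : (ℕ → ℕ) → ℕ → ℕ → ℕ → ℕ → ℕ
ramp s a b zero    zero          = a
ramp s a b zero    (suc zero)    = b
ramp s a b zero    (suc (suc l)) = b ℕ.* s (suc (suc l))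
ramp s a b (suc m) zero          = 0
ramp s a b (suc m) (suc l)       = ramp (λ k → s (suc k)) a b m l

ramp-at : ∀ s a b m → ramp s a b m m ≡ a
ramp-at s a b zero    = refl
ramp-at s a b (suc m) = ramp-at (λ k → s (suc k)) a b m

ramp-next : ∀ s a b m {l} → l ≡ suc m → ramp s a b m l ≡ b
ramp-next s a b zero    refl = refl
ramp-next s a b (suc m) refl = ramp-next (λ k → s (suc k)) a b m refl

ramp-rises : ∀ s a b → (∀ k → 0 < s k) → ∀ m l → l ≢ m →
  ramp s a b m l ℕ.* s (suc l) ≤ ramp s a b m (suc l) ℕ.* s l
ramp-rises s a b s>0 zero    zero          0≢0 = contradiction refl 0≢0
ramp-rises s a b s>0 zero    (suc zero)    _   = ℕₚ.m≤m*n (b ℕ.* s 2) (s 1) {{ℕ.>-nonZero (s>0 1)}}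
ramp-rises s a b s>0 zero    (suc (suc l)) _   = ℕₚ.≤-reflexive (xy∙z≈xz∙y b _ _)
ramp-rises s a b s>0 (suc m) zero          _   = z≤n
ramp-rises s a b s>0 (suc m) (suc l)       l≢m =
  ramp-rises (λ k → s (suc k)) a b (λ k → s>0 (suc k)) m l (λ l≡m → l≢m (cong suc l≡m))

gorensteinPoint⇒first≡1 : ∀ {s n} {c : Point n} → GorensteinPoint s n c →
  ∀ i → toℕ i ≡ 0 → c i ≡ + 1
gorensteinPoint⇒first≡1 {s} {n} {c} (c° , shifts) i i≡0 =
  ≤-antisym (≮⇒≥ 1≮cᵢ) (i<j⇒suc[i]≤j (proj₁ c° i i≡0))
  where
  1≮cᵢ : ¬ (+ 1 ℤ.< c i)
  1≮cᵢ 1<cᵢ = 0≰-e₀ᵢ (proj₁ -e₀-cone i i≡0)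
    where
    0≰-e₀ᵢ : ¬ (+ 0 ℤ.≤ -e₀ (toℕ i))
    0≰-e₀ᵢ rewrite i≡0 = λ ()
    first° : ∀ k → toℕ k ≡ 0 → + 0 ℤ.< c k + -e₀ (toℕ k)
    first° k k≡0 with toℕ-injective (trans k≡0 (sym i≡0))
    ... | refl rewrite i≡0 = +-monoˡ-< -[1+ 0 ] 1<cᵢ
    rises° : ∀ k l → toℕ l ≡ suc (toℕ k) →
      (c k + -e₀ (toℕ k)) * + s (toℕ l) ℤ.< (c l + -e₀ (toℕ l)) * + s (toℕ k)
    rises° k l l≡1+k = cross-+-<-≤ (c k) (c l) _ _ _ _ (proj₂ c° k l l≡1+k)
      (RisesAt⇒transition s -e₀ k l l≡1+k (-e₀-rises s (toℕ k)))
    -e₀-cone : InCone s n (λ k → -e₀ (toℕ k))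
    -e₀-cone = shifts⇒cone {s} {c = c} shifts (first° , rises°)

interior-+-ramp : ∀ {s n} {c : Point n} → (∀ k → 0 < s k) → InInterior s n c →
  ∀ i j → toℕ j ≡ suc (toℕ i) → ∀ a b →
  + gcd (s (toℕ j)) (s (toℕ i)) + + b * + s (toℕ i) ≡ + a * + s (toℕ j) →
  c i * + s (toℕ j) + + gcd (s (toℕ j)) (s (toℕ i)) ℤ.< c j * + s (toℕ i) →
  InInterior s n (c ⊕ λ k → + ramp s a b (toℕ i) (toℕ k))
interior-+-ramp {s} {n} {c} s>0 (c₀ , c-rises) i j j≡1+i a b bézout gap =
  (λ k k≡0 → +-mono-<-≤ (c₀ k k≡0) (+≤+ z≤n)) , rises
  where
  Y : ℕ → ℕ
  Y = ramp s a b (toℕ i)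
  rises : ∀ k l → toℕ l ≡ suc (toℕ k) →
    (c k + + Y (toℕ k)) * + s (toℕ l) ℤ.< (c l + + Y (toℕ l)) * + s (toℕ k)
  rises k l l≡1+k with toℕ k ℕₚ.≟ toℕ i
  ... | no k≢i = cross-+-<-≤ (c k) (c l) _ _ _ _ (c-rises k l l≡1+k)
    (RisesAt⇒transition s (λ m → + Y m) k l l≡1+k
      (ℕ-RisesAt s Y (toℕ k) (ramp-rises s a b s>0 (toℕ i) (toℕ k) k≢i)))
  ... | yes k≡i with toℕ-injective k≡i
                   | toℕ-injective (trans l≡1+k (trans (cong suc k≡i) (sym j≡1+i)))
  ... | refl | refl = subst₂ (λ α β → (c i + + α) * + s (toℕ j) ℤ.< (c j + + β) * + s (toℕ i))
    (sym (ramp-at s a b (toℕ i))) (sym (ramp-next s a b (toℕ i) j≡1+i))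
    (gap-+-bézout (c i) (c j) (+ a) (+ b) _ _ _ gap bézout)

gorensteinPoint⇒recurrence : ∀ {s n} {c : Point n} → (∀ k → 0 < s k) → GorensteinPoint s n c →
  ∀ (i j : Fin n) → toℕ j ≡ suc (toℕ i) →
  c j * + s (toℕ i) ≡ c i * + s (toℕ j) + + gcd (s (toℕ j)) (s (toℕ i))
gorensteinPoint⇒recurrence {s} {n} {c} s>0 (c° , shifts) i j j≡1+i =
  ≤-antisym (≮⇒≥ no-gap) (<⇒+gcd≤ (c i) (c j) t u (proj₂ c° i j j≡1+i))
  where
  t = s (toℕ j)
  u = s (toℕ i)
  no-gap : ¬ (c i * + t + + gcd t u ℤ.< c j * + u)
  no-gap gap with bézout⁺ t u (s>0 _) (s>0 _)
  ... | a , b , g+bu≡at = <⇒≱ bu<at at≤bu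
    where
    g+bu≡atℤ : + gcd t u + + b * + u ≡ + a * + t
    g+bu≡atℤ = begin
      + gcd t u + + b * + u     ≡⟨ cong (λ z → + gcd t u + z) (pos-* b u) ⟨
      + gcd t u + + (b ℕ.* u)   ≡⟨ pos-+ (gcd t u) (b ℕ.* u) ⟨
      + (gcd t u ℕ.+ b ℕ.* u)   ≡⟨ cong +_ g+bu≡at ⟩
      + (a ℕ.* t)               ≡⟨ pos-* a t ⟩
      + a * + t                 ∎
      where open ≡-Reasoning
    bu<at : + b * + u ℤ.< + a * + t
    bu<at = subst (+ b * + u ℤ.<_) (trans (+-comm (+ b * + u) (+ gcd t u)) g+bu≡atℤ)
              (i<i+gcd (+ b * + u) t u (s>0 _))
    ramp-cone : InCone s n (λ k → + ramp s a b (toℕ i) (toℕ k))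
    ramp-cone = shifts⇒cone {s} {c = c} shifts (interior-+-ramp s>0 c° i j j≡1+i a b g+bu≡atℤ gap)
    at≤bu : + a * + t ℤ.≤ + b * + u
    at≤bu = subst₂ (λ α β → + α * + t ℤ.≤ + β * + u)
      (ramp-at s a b (toℕ i)) (ramp-next s a b (toℕ i) j≡1+i)
      (proj₂ ramp-cone i j j≡1+i)

recurrence⇒interior : ∀ {s n} {c : Point n} → (∀ k → 0 < s k) → Recurrence s n c →
  InInterior s n c
recurrence⇒interior {s} {c = c} s>0 (c₀≡1 , c-rec) =
  (λ i i≡0 → subst (+ 0 ℤ.<_) (sym (c₀≡1 i i≡0)) (+<+ ℕₚ.0<1+n)) ,
  (λ i j j≡1+i → subst (c i * + s (toℕ j) ℤ.<_) (sym (c-rec i j j≡1+i))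
                   (i<i+gcd _ _ _ (s>0 (toℕ j))))

interior⇒shifted-cone : ∀ {s n} {c x : Point n} → Recurrence s n c → InInterior s n x →
  InCone s n (λ i → x i - c i)
interior⇒shifted-cone {c = c} {x} (c₀≡1 , c-rec) (x₀ , x-rises) =
  (λ i i≡0 → i≤j⇒0≤j-i (subst (ℤ._≤ x i) (sym (c₀≡1 i i≡0)) (i<j⇒suc[i]≤j (x₀ i i≡0)))) ,
  (λ i j j≡1+i → gap-shift (x i) (x j) (c i) (c j) _ _ _
    (<⇒+gcd≤ (x i) (x j) _ _ (x-rises i j j≡1+i)) (c-rec i j j≡1+i))

recurrence⇒gorensteinPoint : ∀ {s n} {c : Point n} → (∀ k → 0 < s k) → Recurrence s n c →
  GorensteinPoint s n c
recurrence⇒gorensteinPoint {s} {n} {c} s>0 c-rec = c° , λ x → mk⇔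
  (λ x° → (λ i → x i - c i) , interior⇒shifted-cone {s} c-rec x° ,
          λ i → sym (c+[x-c]≡x (c i) (x i)))
  (λ (y , y-cone , x≡c+y) →
     InInterior-resp-≗ {s} (λ i → sym (x≡c+y i)) (interior-+-cone {s} c° y-cone))
  where
  c° : InInterior s n c
  c° = recurrence⇒interior s>0 c-rec
  c+[x-c]≡x : ∀ c x → c + (x - c) ≡ x
  c+[x-c]≡x = ℤ-Solver.solve-∀

corollary2p6 : (s : ℕ → ℕ) → (∀ k → 0 < s k) → (n : ℕ) → 1 ≤ n →
    GorensteinCone s n ⇔
    Σ (Point n) (λ c →
      (∀ (i : Fin n) → toℕ i ≡ 0 → c i ≡ + 1) ×
      (∀ (i j : Fin n) → toℕ j ≡ suc (toℕ i) →
         c j * + s (toℕ i) ≡ c i * + s (toℕ j) + + gcd (s (toℕ j)) (s (toℕ i))))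
corollary2p6 s s>0 n _ = mk⇔
  (λ (c , c-gor) → c , gorensteinPoint⇒first≡1 {s} c-gor , gorensteinPoint⇒recurrence s>0 c-gor)
  (λ (c , c-rec) → c , recurrence⇒gorensteinPoint s>0 c-rec)
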